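{- If a $\mathsf{BST}^{\otimes}$-formula is satisfied by a partition $\Sigma$, then it is satisfied by every partition $\overline{\Sigma}$ with $\Sigma\subseteq\overline{\Sigma}$.
   Context: Sets are elements of the von Neumann universe of well-founded sets. For sets $s,t$, $s\otimes t:=\{\{u,v\} : u\in s,\ v\in t\}$. $\mathsf{BST}^{\otimes}$-formulae are propositional combinations of atoms $x=y\cup z$, $x=y\cap z$, $x=y\setminus z$, $x=y\otimes z$, $x\subseteq y$ ($x,y,z$ set variables), interpreted in the usual way. A partition is a set of pairwise disjoint nonempty sets (blocks). A partition $\Sigma$ satisfies a formula $\Phi$ if there is a map $\mathfrak{I}:\mathrm{Vars}(\Phi)\to\mathcal{P}(\Sigma)$ (power set) such that the assignment $v\mapsto\bigcup\mathfrak{I}(v)$ makes $\Phi$ true. -}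

module Defs where

-- Well-founded (von Neumann) sets via Aczel's model of iterative sets:
-- a set is given by an index type and a family of (smaller) sets.
-- Equality is extensional equality (bisimulation).

open import Data.Nat using (ℕ)
open import Data.Bool using (Bool; true; false; if_then_else_)
open import Data.Empty using (⊥)
open import Data.Product using (Σ; ∃; _×_; _,_; proj₁; proj₂)
open import Data.Sum using (_⊎_; inj₁; inj₂; [_,_])
open import Relation.Nullary using (¬_)

data V : Set₁ where
  sup : (A : Set) → (A → V) → V

Idx : V → Set
Idx (sup A f) = A

elt : (x : V) → Idx x → V
elt (sup A f) = f

infix 4 _≐_ _∈_ _⊆_
_≐_ : V → V → Set
sup A f ≐ sup B g =
  ((a : A) → Σ B λ b → f a ≐ g b) × ((b : B) → Σ A λ a → f a ≐ g b)

_∈_ : V → V → Set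
x ∈ y = Σ (Idx y) λ b → x ≐ elt y b

_⊆_ : V → V → Set
x ⊆ y = (a : Idx x) → elt x a ∈ y

infixl 6 _∪_ _∖_
infixl 7 _∩_ _⊗_

_∪_ : V → V → V
y ∪ z = sup (Idx y ⊎ Idx z) [ elt y , elt z ]

_∩_ : V → V → V
y ∩ z = sup (Σ (Idx y) λ a → elt y a ∈ z) (λ p → elt y (proj₁ p))

_∖_ : V → V → V
y ∖ z = sup (Σ (Idx y) λ a → ¬ (elt y a ∈ z)) (λ p → elt y (proj₁ p))

pair : V → V → V
pair u v = sup Bool (λ b → if b then u else v)

_⊗_ : V → V → V
s ⊗ t = sup (Idx s × Idx t) (λ p → pair (elt s (proj₁ p)) (elt t (proj₂ p)))

⋃ : V → V
⋃ x = sup (Σ (Idx x) λ a → Idx (elt x a)) (λ p → elt (elt x (proj₁ p)) (proj₂ p))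

record IsPartition (S : V) : Set₁ where
  field
    nonempty : (a : Idx S) → Σ V λ u → u ∈ elt S a
    disjoint : (a b : Idx S) → (Σ V λ u → (u ∈ elt S a) × (u ∈ elt S b)) →
               elt S a ≐ elt S b

Var : Set
Var = ℕ

data Formula : Set where
  _≔_∪_ : Var → Var → Var → Formula
  _≔_∩_ : Var → Var → Var → Formula
  _≔_∖_ : Var → Var → Var → Formula
  _≔_⊗_ : Var → Var → Var → Formula
  _⊑_   : Var → Var → Formula
  ¬ᶠ_   : Formula → Formula
  _∧ᶠ_  : Formula → Formula → Formula
  _∨ᶠ_  : Formula → Formula → Formula
  _⇒ᶠ_  : Formula → Formula → Formula

⟦_⟧ : Formula → (Var → V) → Set
⟦ x ≔ y ∪ z ⟧ M = M x ≐ M y ∪ M z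
⟦ x ≔ y ∩ z ⟧ M = M x ≐ M y ∩ M z
⟦ x ≔ y ∖ z ⟧ M = M x ≐ M y ∖ M z
⟦ x ≔ y ⊗ z ⟧ M = M x ≐ M y ⊗ M z
⟦ x ⊑ y ⟧ M = M x ⊆ M y
⟦ ¬ᶠ φ ⟧ M = ¬ ⟦ φ ⟧ M
⟦ φ ∧ᶠ ψ ⟧ M = ⟦ φ ⟧ M × ⟦ ψ ⟧ M
⟦ φ ∨ᶠ ψ ⟧ M = ⟦ φ ⟧ M ⊎ ⟦ ψ ⟧ M
⟦ φ ⇒ᶠ ψ ⟧ M = ⟦ φ ⟧ M → ⟦ ψ ⟧ M

-- A partition S satisfies Φ if there is a map I from variables into
-- the power set of S (i.e. I v ⊆ S) such that v ↦ ⋃ (I v) makes Φ true.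
Satisfies : V → Formula → Set₁
Satisfies S Φ =
  Σ (Var → V) λ I → ((v : Var) → I v ⊆ S) × ⟦ Φ ⟧ (λ v → ⋃ (I v))

{-# OPTIONS --safe #-}
module Submission where

open import Defs
open import Data.Product using (_,_)

≐-trans : (x y z : V) → x ≐ y → y ≐ z → x ≐ z
≐-trans (sup A f) (sup B g) (sup C h) (x→y , y→x) (y→z , z→y) =
  (λ a → let (b , fa≐gb) = x→y a ; (c , gb≐hc) = y→z b
         in c , ≐-trans (f a) (g b) (h c) fa≐gb gb≐hc) ,
  (λ c → let (b , gb≐hc) = z→y c ; (a , fa≐gb) = y→x b
         in a , ≐-trans (f a) (g b) (h c) fa≐gb gb≐hc)

⊆-trans : (x y z : V) → x ⊆ y → y ⊆ z → x ⊆ z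
⊆-trans x y z x⊆y y⊆z a =
  let (b , xa≐yb) = x⊆y a ; (c , yb≐zc) = y⊆z b
  in c , ≐-trans (elt x a) (elt y b) (elt z c) xa≐yb yb≐zc

-- The same interpretation I witnesses satisfaction: v ↦ ⋃ (I v) does not depend on S.
Satisfies-mono : (Φ : Formula) (S S̄ : V) → S ⊆ S̄ → Satisfies S Φ → Satisfies S̄ Φ
Satisfies-mono Φ S S̄ S⊆S̄ (I , I⊆S , ⟦Φ⟧) =
  I , (λ v → ⊆-trans (I v) S S̄ (I⊆S v) S⊆S̄) , ⟦Φ⟧

lemma1 : (Φ : Formula) (S S̄ : V) → IsPartition S → IsPartition S̄ →
    S ⊆ S̄ → Satisfies S Φ → Satisfies S̄ Φ
lemma1 Φ S S̄ _ _ = Satisfies-mono Φ S S̄
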